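{- Call a set $A\subseteq\mathbb{Z}_n$ ($n$ a positive integer) a counterexample if: $A$ is not contained in a coset of a proper subgroup of $\mathbb{Z}_n$; $|2A|<\min\{\frac94|A|,n\}$; and none of the following holds: (i) $|2A|-|A|\ge C_0^{ -1}n$ with $C_0=2.4\cdot10^4$; (ii) there are a proper subgroup $H<\mathbb{Z}_n$ and an arithmetic progression $P$ with $|P|>1$ such that $A\subseteq P+H$ and $(|P|-1)|H|\le|2A|-|A|$; (iii) there is a proper subgroup $H<\mathbb{Z}_n$ such that $A$ meets exactly three $H$-cosets, these cosets do not form an arithmetic progression in $\mathbb{Z}_n/H$, and $3|H|\le|2A|-|A|$. Suppose a counterexample exists for some $n$; let $n$ be the smallest such positive integer and $A\subseteq\mathbb{Z}_n$ a counterexample. Then $|2A+L|-|2A|>|A+L|-|A|$ for every nonzero subgroup $L<\mathbb{Z}_n$ with $2A+L\ne\mathbb{Z}_n$.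
   Context: $\mathbb{Z}_n$ is the cyclic group of order $n$; $2A=A+A$. An arithmetic progression with $N\ge2$ terms is $\{g,g+d,\dots,g+(N-1)d\}$. A set meets a coset if it intersects it. -}

module Defs where

open import Data.Nat using (ℕ; zero; suc; NonZero; _<_; _≤_; _*_; _∸_) renaming (_+_ to _+ℕ_)
open import Data.Nat.DivMod using (_%_; m%n<n)
open import Data.Fin using (Fin; toℕ; fromℕ<; _≟_)
open import Data.Fin.Subset using (Subset; _∈_; _∉_; _⊆_; ∣_∣)
open import Data.Vec using (tabulate; lookup)
open import Data.Bool using (Bool; true; false; _∨_; _∧_)
open import Data.Product using (Σ; _×_)
open import Data.Sum using (_⊎_)
open import Relation.Nullary using (¬_)
open import Relation.Nullary.Decidable using (⌊_⌋)
open import Relation.Binary.PropositionalEquality using (_≡_; _≢_)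

[_] : ∀ {n} {{_ : NonZero n}} → ℕ → Fin n
[_] {n} m = fromℕ< (m%n<n m n)

0ₙ : ∀ {n} {{_ : NonZero n}} → Fin n
0ₙ = [ 0 ]

infixl 6 _⊕_ _⊝_
_⊕_ : ∀ {n} {{_ : NonZero n}} → Fin n → Fin n → Fin n
x ⊕ y = [ toℕ x +ℕ toℕ y ]

⊖_ : ∀ {n} {{_ : NonZero n}} → Fin n → Fin n
⊖_ {n} x = [ n ∸ toℕ x ]

_⊝_ : ∀ {n} {{_ : NonZero n}} → Fin n → Fin n → Fin n
x ⊝ y = x ⊕ (⊖ y)

infixl 7 _·_
_·_ : ∀ {n} {{_ : NonZero n}} → ℕ → Fin n → Fin n
i · d = [ i * toℕ d ]

anyFin : ∀ {m} → (Fin m → Bool) → Bool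
anyFin {zero} f = false
anyFin {suc m} f = f Fin.zero ∨ anyFin (λ i → f (Fin.suc i))

anyBelow : ℕ → (ℕ → Bool) → Bool
anyBelow zero f = false
anyBelow (suc N) f = f N ∨ anyBelow N f

infixl 6 _+ₛ_
_+ₛ_ : ∀ {n} {{_ : NonZero n}} → Subset n → Subset n → Subset n
A +ₛ B = tabulate λ z → anyFin λ x → anyFin λ y →
  lookup A x ∧ lookup B y ∧ ⌊ x ⊕ y ≟ z ⌋

AP : ∀ {n} {{_ : NonZero n}} → Fin n → Fin n → ℕ → Subset n
AP g d N = tabulate λ z → anyBelow N λ i → ⌊ z ≟ g ⊕ i · d ⌋

IsSubgroup : ∀ {n} {{_ : NonZero n}} → Subset n → Set
IsSubgroup H = (0ₙ ∈ H)
  × (∀ x y → x ∈ H → y ∈ H → x ⊕ y ∈ H)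
  × (∀ x → x ∈ H → ⊖ x ∈ H)

Proper : ∀ {n} → Subset n → Set
Proper H = Σ _ λ x → x ∉ H

Nonzero : ∀ {n} {{_ : NonZero n}} → Subset n → Set
Nonzero L = Σ _ λ x → x ∈ L × x ≢ 0ₙ

SameCoset : ∀ {n} {{_ : NonZero n}} → Subset n → Fin n → Fin n → Set
SameCoset H x y = x ⊝ y ∈ H

InProperCoset : ∀ {n} {{_ : NonZero n}} → Subset n → Set
InProperCoset A = Σ _ λ H → IsSubgroup H × Proper H ×
  Σ _ λ g → ∀ a → a ∈ A → SameCoset H a g

CondI : (n : ℕ) {{_ : NonZero n}} → Subset n → Set
CondI n A = n +ℕ 24000 * ∣ A ∣ ≤ 24000 * ∣ A +ₛ A ∣

CondII : (n : ℕ) {{_ : NonZero n}} → Subset n → Set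
CondII n A = Σ _ λ H → IsSubgroup H × Proper H ×
  Σ _ λ g → Σ _ λ d → Σ ℕ λ N → 2 ≤ N × 1 < ∣ AP g d N ∣ ×
  A ⊆ AP g d N +ₛ H ×
  (∣ AP g d N ∣ ∸ 1) * ∣ H ∣ +ℕ ∣ A ∣ ≤ ∣ A +ₛ A ∣

CosetsFormAP : ∀ {n} {{_ : NonZero n}} → Subset n → Fin n → Fin n → Fin n → Set
CosetsFormAP H a b c = Σ _ λ g → Σ _ λ d → Σ ℕ λ N → 2 ≤ N ×
  (∀ x → ((SameCoset H x a ⊎ SameCoset H x b ⊎ SameCoset H x c) →
             Σ ℕ λ i → i < N × SameCoset H x (g ⊕ i · d))
       × ((Σ ℕ λ i → i < N × SameCoset H x (g ⊕ i · d)) →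
             (SameCoset H x a ⊎ SameCoset H x b ⊎ SameCoset H x c)))

CondIII : (n : ℕ) {{_ : NonZero n}} → Subset n → Set
CondIII n A = Σ _ λ H → IsSubgroup H × Proper H ×
  Σ _ λ a → Σ _ λ b → Σ _ λ c → a ∈ A × b ∈ A × c ∈ A ×
  ¬ SameCoset H a b × ¬ SameCoset H a c × ¬ SameCoset H b c ×
  (∀ x → x ∈ A → SameCoset H x a ⊎ SameCoset H x b ⊎ SameCoset H x c) ×
  ¬ CosetsFormAP H a b c ×
  3 * ∣ H ∣ +ℕ ∣ A ∣ ≤ ∣ A +ₛ A ∣

Counterexample : (n : ℕ) {{_ : NonZero n}} → Subset n → Set
Counterexample n A = ¬ InProperCoset A
  × 4 * ∣ A +ₛ A ∣ < 9 * ∣ A ∣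
  × ∣ A +ₛ A ∣ < n
  × ¬ CondI n A × ¬ CondII n A × ¬ CondIII n A

{-# OPTIONS --safe #-}

-- A nonzero subgroup L of ℤ_n is the set of multiples of a proper divisor d of n, so reduction
-- mod d, φ : ℤ_n → ℤ_d, has kernel L and |S + L| = (n/d)|φ(S)| for every S. If the inequality
-- failed, B = φ(A) would satisfy (n/d)(|2B| − |B|) ≤ |2A| − |A|. Then B inherits 4|2B| < 9|B|,
-- 2A + L ≠ ℤ_n gives |2B| < d, and each structure excluded for A (a proper coset, or (i)–(iii))
-- pulls back along φ from B to A, with subgroup sizes multiplied by n/d. So B would be a
-- counterexample in ℤ_d with d < n, contradicting the minimality of n.

module Submission where

open import Defs
open import Algebra.Bundles using (AbelianGroup)
open import Data.Bool using (Bool; true; false; _∧_; _∨_)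
open import Data.Bool.Properties using (∨-zeroʳ)
open import Data.Fin as Fin using (Fin; toℕ; _≟_)
open import Data.Fin.Properties using (toℕ-injective; toℕ-fromℕ<; toℕ<n)
import Data.Fin.Properties as Finₚ
open import Data.Fin.Subset using (Subset; _∈_; _∉_; _⊆_; ∣_∣; ⊤; ⁅_⁆; _-_)
open import Data.Fin.Subset.Properties
  using ( x∈⁅x⁆; x∈⁅y⁆⇒x≡y; ∣⁅x⁆∣≡1; _∈?_; x∈p∧x≢y⇒x∈p-y; x∈p⇒∣p-x∣<∣p∣; p⊆q⇒∣p∣≤∣q∣
        ; ⊆-antisym; ∣p∣≤n; ∣p∣≡n⇒p≡⊤)
open import Data.Nat
  using (ℕ; pred; zero; suc; NonZero; _+_; _*_; _∸_; _<_; _≤_; _≰_; z≤n; s≤s; s≤s⁻¹; _≤?_; >-nonZero⁻¹)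
open import Data.Nat.DivMod
  using ( _%_; _/_; m%n<n; m≡m%n+[m/n]*n; m<n⇒m%n≡m; n%n≡0; %-distribˡ-+; %-distribˡ-*; m%n%n≡m%n
        ; m∣n⇒o%n%m≡o%m; m/n*n≡m; [m+n]%n≡m%n)
open import Data.Nat.Divisibility using (_∣_; divides; ∣-refl; m%n≡0⇒n∣m; n∣m⇒m%n≡0; ∣m∣n⇒∣m+n)
open import Data.Nat.Properties hiding (_≟_)
open import Data.Nat.Tactic.RingSolver using (solve-∀)
open import Data.Product using (∃-syntax; _×_; _,_; proj₁; proj₂)
open import Data.Sum using (_⊎_; inj₁; inj₂)
import Data.Sum as Sum
open import Data.Vec using ([]; _∷_; tabulate; lookup; here; there)
open import Data.Vec.Properties using (lookup∘tabulate; tabulate∘lookup; []=⇒lookup; lookup⇒[]=)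
open import Function using (_∘_; _⇔_; mk⇔; Equivalence)
open import Level using (0ℓ)
open import Relation.Nullary using (¬_; Dec; yes; no; contradiction)
open import Relation.Nullary.Decidable using (⌊_⌋)
open import Relation.Unary using (Decidable)
open import Relation.Binary.Definitions using (tri<; tri≈; tri>)
open import Relation.Binary.PropositionalEquality hiding ([_])

true-∧⁻ : ∀ {a b : Bool} → a ∧ b ≡ true → a ≡ true × b ≡ true
true-∧⁻ {true} {true} _ = refl , refl

true-∧⁺ : ∀ {a b : Bool} → a ≡ true → b ≡ true → a ∧ b ≡ true
true-∧⁺ refl refl = refl

⌊⌋-true⁻ : ∀ {a} {A : Set a} (a? : Dec A) → ⌊ a? ⌋ ≡ true → A
⌊⌋-true⁻ (yes a) _ = a

⌊⌋-true⁺ : ∀ {a} {A : Set a} (a? : Dec A) → A → ⌊ a? ⌋ ≡ true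
⌊⌋-true⁺ (yes _) _ = refl
⌊⌋-true⁺ (no ¬a) a = contradiction a ¬a

anyFin-true⁻ : ∀ {m} (f : Fin m → Bool) → anyFin f ≡ true → ∃[ i ] f i ≡ true
anyFin-true⁻ {suc m} f any with f Fin.zero in eq
... | true = Fin.zero , eq
... | false with anyFin-true⁻ (f ∘ Fin.suc) any
...   | i , fi = Fin.suc i , fi

anyFin-true⁺ : ∀ {m} (f : Fin m → Bool) {i} → f i ≡ true → anyFin f ≡ true
anyFin-true⁺ f {Fin.zero} fi rewrite fi = refl
anyFin-true⁺ f {Fin.suc i} fi = trans (cong (f Fin.zero ∨_) (anyFin-true⁺ (f ∘ Fin.suc) fi)) (∨-zeroʳ _)

anyBelow-true⁻ : ∀ N (f : ℕ → Bool) → anyBelow N f ≡ true → ∃[ i ] i < N × f i ≡ true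
anyBelow-true⁻ (suc N) f any with f N in eq
... | true = N , ≤-refl , eq
... | false with anyBelow-true⁻ N f any
...   | i , i<N , fi = i , m<n⇒m<1+n i<N , fi

anyBelow-true⁺ : ∀ N (f : ℕ → Bool) {i} → i < N → f i ≡ true → anyBelow N f ≡ true
anyBelow-true⁺ (suc N) f i<1+N fi with m≤n⇒m<n∨m≡n (s≤s⁻¹ i<1+N)
... | inj₁ i<N = trans (cong (f N ∨_) (anyBelow-true⁺ N f i<N fi)) (∨-zeroʳ _)
... | inj₂ refl = cong (_∨ anyBelow N f) fi

∈-tabulate⁻ : ∀ {m} (f : Fin m → Bool) {x} → x ∈ tabulate f → f x ≡ true
∈-tabulate⁻ f {x} x∈ = trans (sym (lookup∘tabulate f x)) ([]=⇒lookup x∈)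

∈-tabulate⁺ : ∀ {m} (f : Fin m → Bool) {x} → f x ≡ true → x ∈ tabulate f
∈-tabulate⁺ f {x} fx = lookup⇒[]= x (tabulate f) (trans (lookup∘tabulate f x) fx)

x∈p∧y∈p∧x≢y⇒1<∣p∣ : ∀ {m} {p : Subset m} {x y} → x ∈ p → y ∈ p → x ≢ y → 1 < ∣ p ∣
x∈p∧y∈p∧x≢y⇒1<∣p∣ {p = p} {x} {y} x∈ y∈ x≢y = begin-strict
  1          ≡⟨ ∣⁅x⁆∣≡1 y ⟨
  ∣ ⁅ y ⁆ ∣  ≤⟨ p⊆q⇒∣p∣≤∣q∣ ⁅y⁆⊆p-x ⟩
  ∣ p - x ∣  <⟨ x∈p⇒∣p-x∣<∣p∣ x∈ ⟩
  ∣ p ∣      ∎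
  where
  open ≤-Reasoning
  ⁅y⁆⊆p-x : ⁅ y ⁆ ⊆ p - x
  ⁅y⁆⊆p-x z∈ rewrite x∈⁅y⁆⇒x≡y y z∈ = x∈p∧x≢y⇒x∈p-y y∈ (x≢y ∘ sym)

injection⇒∣p∣≤∣q∣ : ∀ {m k} (p : Subset m) (q : Subset k) (f : Fin m → Fin k) →
  (∀ {x} → x ∈ p → f x ∈ q) → (∀ {x y} → x ∈ p → y ∈ p → f x ≡ f y → x ≡ y) → ∣ p ∣ ≤ ∣ q ∣
injection⇒∣p∣≤∣q∣ [] q f into inj = z≤n
injection⇒∣p∣≤∣q∣ (false ∷ p) q f into inj =
  injection⇒∣p∣≤∣q∣ p q (f ∘ Fin.suc) (into ∘ there)
    (λ x∈ y∈ → Finₚ.suc-injective ∘ inj (there x∈) (there y∈))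
injection⇒∣p∣≤∣q∣ (true ∷ p) q f into inj = begin-strict
  ∣ p ∣              ≤⟨ injection⇒∣p∣≤∣q∣ p (q - f Fin.zero) (f ∘ Fin.suc) into′
                          (λ x∈ y∈ → Finₚ.suc-injective ∘ inj (there x∈) (there y∈)) ⟩
  ∣ q - f Fin.zero ∣ <⟨ x∈p⇒∣p-x∣<∣p∣ (into here) ⟩
  ∣ q ∣              ∎
  where
  open ≤-Reasoning
  into′ : ∀ {x} → x ∈ p → f (Fin.suc x) ∈ q - f Fin.zero
  into′ x∈ = x∈p∧x≢y⇒x∈p-y (into (there x∈)) (λ eq → Finₚ.0≢1+n (sym (inj (there x∈) here eq)))

countBelow : ℕ → (ℕ → Bool) → ℕ
countBelow zero h = 0
countBelow (suc N) h = ∣ h 0 ∷ [] ∣ + countBelow N (h ∘ suc)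

∣tabulate∣≡countBelow : ∀ {m} (f : Fin m → Bool) (h : ℕ → Bool) → (∀ x → f x ≡ h (toℕ x)) →
  ∣ tabulate f ∣ ≡ countBelow m h
∣tabulate∣≡countBelow {zero} f h f≗h = refl
∣tabulate∣≡countBelow {suc m} f h f≗h rewrite f≗h Fin.zero with h 0
... | true = cong suc (∣tabulate∣≡countBelow (f ∘ Fin.suc) (h ∘ suc) (f≗h ∘ Fin.suc))
... | false = ∣tabulate∣≡countBelow (f ∘ Fin.suc) (h ∘ suc) (f≗h ∘ Fin.suc)

countBelow-cong : ∀ N {h h′ : ℕ → Bool} → (∀ i → h i ≡ h′ i) → countBelow N h ≡ countBelow N h′
countBelow-cong zero h≗h′ = refl
countBelow-cong (suc N) h≗h′ = cong₂ _+_ (cong (λ b → ∣ b ∷ [] ∣) (h≗h′ 0)) (countBelow-cong N (h≗h′ ∘ suc))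

countBelow-+ : ∀ a b (h : ℕ → Bool) → countBelow (a + b) h ≡ countBelow a h + countBelow b (λ i → h (a + i))
countBelow-+ zero b h = refl
countBelow-+ (suc a) b h =
  trans (cong (∣ h 0 ∷ [] ∣ +_) (countBelow-+ a b (h ∘ suc))) (sym (+-assoc ∣ h 0 ∷ [] ∣ _ _))

countBelow-periodic : ∀ q d (h : ℕ → Bool) → (∀ i → h (d + i) ≡ h i) → countBelow (q * d) h ≡ q * countBelow d h
countBelow-periodic zero d h periodic = refl
countBelow-periodic (suc q) d h periodic = begin
  countBelow (d + q * d) h                                ≡⟨ countBelow-+ d (q * d) h ⟩
  countBelow d h + countBelow (q * d) (λ i → h (d + i))   ≡⟨ cong (countBelow d h +_) (countBelow-cong (q * d) periodic) ⟩
  countBelow d h + countBelow (q * d) h                   ≡⟨ cong (countBelow d h +_) (countBelow-periodic q d h periodic) ⟩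
  countBelow d h + q * countBelow d h                     ∎
  where open ≡-Reasoning

minimal-witness : ∀ {p} (P : ℕ → Set p) → Decidable P → ∀ {w} → P w →
  ∃[ m ] P m × m ≤ w × (∀ {j} → j < m → ¬ P j)
minimal-witness P P? {w} Pw = search 0 w refl (λ ())
  where
  search : ∀ j b → j + b ≡ w → (∀ {i} → i < j → ¬ P i) → ∃[ m ] P m × m ≤ w × (∀ {i} → i < m → ¬ P i)
  search j zero j+0≡w below = j , subst P j≡w Pw , ≤-reflexive (sym j≡w) , below
    where j≡w = trans (sym j+0≡w) (+-identityʳ j)
  search j (suc b) j+b≡w below with P? j
  ... | yes Pj = j , Pj , subst (j ≤_) j+b≡w (m≤m+n j (suc b)) , below
  ... | no ¬Pj = search (suc j) b (trans (sym (+-suc j b)) j+b≡w) below′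
    where
    below′ : ∀ {i} → i < suc j → ¬ P i
    below′ i<1+j with m≤n⇒m<n∨m≡n (s≤s⁻¹ i<1+j)
    ... | inj₁ i<j = below i<j
    ... | inj₂ refl = ¬Pj

excess-transfer : ∀ {R x} k b b₂ a a₂ → R ≤ k * x → x + b ≤ b₂ → k * b₂ + a ≤ k * b + a₂ → R + a ≤ a₂
excess-transfer {R} {x} k b b₂ a a₂ R≤kx x+b≤b₂ excess = +-cancelˡ-≤ (k * b) (R + a) a₂ (begin
  k * b + (R + a)     ≡⟨ rearrange k b R a ⟩
  R + k * b + a       ≤⟨ +-monoˡ-≤ a (+-monoˡ-≤ (k * b) R≤kx) ⟩
  k * x + k * b + a   ≡⟨ cong (_+ a) (*-distribˡ-+ k x b) ⟨
  k * (x + b) + a     ≤⟨ +-monoˡ-≤ a (*-monoʳ-≤ k x+b≤b₂) ⟩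
  k * b₂ + a          ≤⟨ excess ⟩
  k * b + a₂          ∎)
  where
  open ≤-Reasoning
  rearrange : ∀ k b R a → k * b + (R + a) ≡ R + k * b + a
  rearrange = solve-∀

excess-scale : ∀ c k b b₂ a a₂ → k * b₂ + a ≤ k * b + a₂ → k * (c * b₂) + c * a ≤ k * (c * b) + c * a₂
excess-scale c k b b₂ a a₂ excess = begin
  k * (c * b₂) + c * a   ≡⟨ distribute c k b₂ a ⟩
  c * (k * b₂ + a)       ≤⟨ *-monoʳ-≤ c excess ⟩
  c * (k * b + a₂)       ≡⟨ distribute c k b a₂ ⟨
  k * (c * b) + c * a₂   ∎
  where
  open ≤-Reasoning
  distribute : ∀ c k b a → k * (c * b) + c * a ≡ c * (k * b + a)
  distribute = solve-∀

small-doubling-transfer : ∀ k b b₂ a a₂ → k * b₂ + a ≤ k * b + a₂ → a ≤ k * b → 4 * a₂ < 9 * a → 4 * b₂ < 9 * b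
small-doubling-transfer k b b₂ a a₂ excess a≤kb 4a₂<9a = *-cancelˡ-< k (4 * b₂) (9 * b) (begin-strict
  k * (4 * b₂)               ≡⟨ swap k 4 b₂ ⟩
  4 * (k * b₂)               <⟨ +-cancelʳ-< (4 * a) _ _ 4kb₂+4a<4kb+5a+4a ⟩
  4 * (k * b) + 5 * a        ≤⟨ +-monoʳ-≤ (4 * (k * b)) (*-monoʳ-≤ 5 a≤kb) ⟩
  4 * (k * b) + 5 * (k * b)  ≡⟨ collect k b ⟩
  k * (9 * b)                ∎)
  where
  open ≤-Reasoning
  swap : ∀ k c b → k * (c * b) ≡ c * (k * b)
  swap = solve-∀
  collect : ∀ k b → 4 * (k * b) + 5 * (k * b) ≡ k * (9 * b)
  collect = solve-∀
  4kb₂+4a<4kb+5a+4a : 4 * (k * b₂) + 4 * a < 4 * (k * b) + 5 * a + 4 * a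
  4kb₂+4a<4kb+5a+4a = begin-strict
    4 * (k * b₂) + 4 * a     ≡⟨ *-distribˡ-+ 4 (k * b₂) a ⟨
    4 * (k * b₂ + a)         ≤⟨ *-monoʳ-≤ 4 excess ⟩
    4 * (k * b + a₂)         ≡⟨ *-distribˡ-+ 4 (k * b) a₂ ⟩
    4 * (k * b) + 4 * a₂     <⟨ +-monoʳ-< (4 * (k * b)) 4a₂<9a ⟩
    4 * (k * b) + 9 * a      ≡⟨ split k b a ⟩
    4 * (k * b) + 5 * a + 4 * a ∎
    where
    split : ∀ k b a → 4 * (k * b) + 9 * a ≡ 4 * (k * b) + 5 * a + 4 * a
    split = solve-∀

module _ {n : ℕ} {{_ : NonZero n}} where

  ∈-+ₛ⁻ : ∀ (A B : Subset n) {z} → z ∈ A +ₛ B → ∃[ x ] ∃[ y ] x ∈ A × y ∈ B × x ⊕ y ≡ z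
  ∈-+ₛ⁻ A B z∈ with anyFin-true⁻ _ (∈-tabulate⁻ _ z∈)
  ... | x , any with anyFin-true⁻ _ any
  ...   | y , x∧y∧eq with true-∧⁻ {lookup A x} x∧y∧eq
  ...     | x∈ , y∧eq with true-∧⁻ {lookup B y} y∧eq
  ...       | y∈ , eq = x , y , lookup⇒[]= x A x∈ , lookup⇒[]= y B y∈ , ⌊⌋-true⁻ (_ ≟ _) eq

  ∈-+ₛ⁺ : ∀ (A B : Subset n) {x y z} → x ∈ A → y ∈ B → x ⊕ y ≡ z → z ∈ A +ₛ B
  ∈-+ₛ⁺ A B {x} {y} x∈ y∈ eq = ∈-tabulate⁺ _ (anyFin-true⁺ _ {x} (anyFin-true⁺ _ {y}
    (true-∧⁺ ([]=⇒lookup x∈) (true-∧⁺ ([]=⇒lookup y∈) (⌊⌋-true⁺ (x ⊕ y ≟ _) eq)))))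

  ∈-AP⁻ : ∀ (g d : Fin n) N {z} → z ∈ AP g d N → ∃[ i ] i < N × z ≡ g ⊕ i · d
  ∈-AP⁻ g d N {z} z∈
    with anyBelow-true⁻ N _ (∈-tabulate⁻ (λ z → anyBelow N λ j → ⌊ z ≟ g ⊕ j · d ⌋) z∈)
  ... | i , i<N , eq = i , i<N , ⌊⌋-true⁻ (z ≟ _) eq

  ∈-AP⁺ : ∀ (g d : Fin n) N {i} → i < N → g ⊕ i · d ∈ AP g d N
  ∈-AP⁺ g d N {i} i<N = ∈-tabulate⁺ (λ z → anyBelow N λ j → ⌊ z ≟ g ⊕ j · d ⌋)
    (anyBelow-true⁺ N (λ j → ⌊ g ⊕ i · d ≟ g ⊕ j · d ⌋) i<N (⌊⌋-true⁺ (g ⊕ i · d ≟ g ⊕ i · d) refl))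

  toℕ-[] : ∀ a → toℕ ([_] {n} a) ≡ a % n
  toℕ-[] a = toℕ-fromℕ< (m%n<n a n)

  []-toℕ : ∀ (x : Fin n) → [ toℕ x ] ≡ x
  []-toℕ x = toℕ-injective (trans (toℕ-[] (toℕ x)) (m<n⇒m%n≡m (toℕ<n x)))

  %≡⇒[]≡ : ∀ {a b} → a % n ≡ b % n → [ a ] ≡ ([_] {n} b)
  %≡⇒[]≡ {a} {b} eq = toℕ-injective (trans (toℕ-[] a) (trans eq (sym (toℕ-[] b))))

  []-+-homo : ∀ a b → [ a ] ⊕ [ b ] ≡ ([_] {n} (a + b))
  []-+-homo a b = %≡⇒[]≡ (begin
    (toℕ [ a ] + toℕ [ b ]) % n ≡⟨ cong₂ (λ u v → (u + v) % n) (toℕ-[] a) (toℕ-[] b) ⟩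
    (a % n + b % n) % n         ≡⟨ %-distribˡ-+ a b n ⟨
    (a + b) % n                 ∎)
    where open ≡-Reasoning

  ·-[] : ∀ i a → i · [ a ] ≡ ([_] {n} (i * a))
  ·-[] i a = %≡⇒[]≡ (begin
    (i * toℕ [ a ]) % n           ≡⟨ cong (λ u → (i * u) % n) (toℕ-[] a) ⟩
    (i * (a % n)) % n             ≡⟨ %-distribˡ-* i (a % n) n ⟩
    (i % n * (a % n % n)) % n     ≡⟨ cong (λ u → (i % n * u) % n) (m%n%n≡m%n a n) ⟩
    (i % n * (a % n)) % n         ≡⟨ %-distribˡ-* i a n ⟨
    (i * a) % n                   ∎)
    where open ≡-Reasoning

  ⊕-comm : ∀ (x y : Fin n) → x ⊕ y ≡ y ⊕ x
  ⊕-comm x y = cong [_] (+-comm (toℕ x) (toℕ y))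

  ⊕-assoc : ∀ (x y z : Fin n) → (x ⊕ y) ⊕ z ≡ x ⊕ (y ⊕ z)
  ⊕-assoc x y z = begin
    [ toℕ x + toℕ y ] ⊕ z            ≡⟨ cong ([ toℕ x + toℕ y ] ⊕_) ([]-toℕ z) ⟨
    [ toℕ x + toℕ y ] ⊕ [ toℕ z ]    ≡⟨ []-+-homo (toℕ x + toℕ y) (toℕ z) ⟩
    [ toℕ x + toℕ y + toℕ z ]        ≡⟨ cong [_] (+-assoc (toℕ x) (toℕ y) (toℕ z)) ⟩
    [ toℕ x + (toℕ y + toℕ z) ]      ≡⟨ []-+-homo (toℕ x) (toℕ y + toℕ z) ⟨
    [ toℕ x ] ⊕ (y ⊕ z)              ≡⟨ cong (_⊕ (y ⊕ z)) ([]-toℕ x) ⟩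
    x ⊕ (y ⊕ z)                      ∎
    where open ≡-Reasoning

  ⊕-identityʳ : ∀ (x : Fin n) → x ⊕ 0ₙ ≡ x
  ⊕-identityʳ x = begin
    x ⊕ [ 0 ]           ≡⟨ cong (_⊕ [ 0 ]) ([]-toℕ x) ⟨
    [ toℕ x ] ⊕ [ 0 ]   ≡⟨ []-+-homo (toℕ x) 0 ⟩
    [ toℕ x + 0 ]       ≡⟨ cong [_] (+-identityʳ (toℕ x)) ⟩
    [ toℕ x ]           ≡⟨ []-toℕ x ⟩
    x                   ∎
    where open ≡-Reasoning

  [n]≡0ₙ : [ n ] ≡ 0ₙ
  [n]≡0ₙ = %≡⇒[]≡ (trans (n%n≡0 n) (sym (m<n⇒m%n≡m (>-nonZero⁻¹ n))))

  ⊕-inverseʳ : ∀ (x : Fin n) → x ⊕ ⊖ x ≡ 0ₙ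
  ⊕-inverseʳ x = begin
    x ⊕ [ n ∸ toℕ x ]           ≡⟨ cong (_⊕ [ n ∸ toℕ x ]) ([]-toℕ x) ⟨
    [ toℕ x ] ⊕ [ n ∸ toℕ x ]   ≡⟨ []-+-homo (toℕ x) (n ∸ toℕ x) ⟩
    [ toℕ x + (n ∸ toℕ x) ]     ≡⟨ cong [_] (m+[n∸m]≡n (<⇒≤ (toℕ<n x))) ⟩
    [ n ]                       ≡⟨ [n]≡0ₙ ⟩
    0ₙ                          ∎
    where open ≡-Reasoning

ℤ-abelianGroup : (n : ℕ) {{_ : NonZero n}} → AbelianGroup 0ℓ 0ℓ
ℤ-abelianGroup n = record
  { Carrier = Fin n ; _≈_ = _≡_ ; _∙_ = _⊕_ ; ε = 0ₙ ; _⁻¹ = ⊖_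
  ; isAbelianGroup = record
    { isGroup = record
      { isMonoid = record
        { isSemigroup = record
          { isMagma = record { isEquivalence = isEquivalence ; ∙-cong = cong₂ _⊕_ }
          ; assoc = ⊕-assoc }
        ; identity = (λ x → trans (⊕-comm 0ₙ x) (⊕-identityʳ x)) , ⊕-identityʳ }
      ; inverse = (λ x → trans (⊕-comm (⊖ x) x) (⊕-inverseʳ x)) , ⊕-inverseʳ
      ; ⁻¹-cong = cong ⊖_ }
    ; comm = ⊕-comm } }

module _ {n : ℕ} {{_ : NonZero n}} where
  open import Algebra.Properties.AbelianGroup (ℤ-abelianGroup n) public
    using (∙-cancelˡ; inverseʳ-unique; x≈z//y; //-rightDividesˡ; xyx⁻¹≈y)

  x⊕[y⊝x]≡y : ∀ (x y : Fin n) → x ⊕ (y ⊝ x) ≡ y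
  x⊕[y⊝x]≡y x y = trans (⊕-comm x (y ⊝ x)) (//-rightDividesˡ x y)

  ·-distribʳ-+ : ∀ i j (x : Fin n) → (i + j) · x ≡ i · x ⊕ j · x
  ·-distribʳ-+ i j x = trans (cong [_] (*-distribʳ-+ (toℕ x) i j)) (sym ([]-+-homo (i * toℕ x) (j * toℕ x)))

  ·-identityˡ : ∀ (x : Fin n) → 1 · x ≡ x
  ·-identityˡ x = trans (cong [_] (+-identityʳ (toℕ x))) ([]-toℕ x)

  ·-zeroʳ : ∀ i → i · 0ₙ {n} ≡ 0ₙ
  ·-zeroʳ i = trans (·-[] i 0) (cong [_] (*-zeroʳ i))

  n·x≡0ₙ : ∀ (x : Fin n) → n · x ≡ 0ₙ
  n·x≡0ₙ x = begin
    [ n * toℕ x ]     ≡⟨ cong [_] (*-comm n (toℕ x)) ⟩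
    [ toℕ x * n ]     ≡⟨ ·-[] (toℕ x) n ⟨
    toℕ x · [ n ]     ≡⟨ cong (toℕ x ·_) [n]≡0ₙ ⟩
    toℕ x · 0ₙ        ≡⟨ ·-zeroʳ (toℕ x) ⟩
    0ₙ                ∎
    where open ≡-Reasoning

  o·x≡0⇒[q*o]·x≡0 : ∀ {o} (x : Fin n) → o · x ≡ 0ₙ → ∀ q → (q * o) · x ≡ 0ₙ
  o·x≡0⇒[q*o]·x≡0 x o·x≡0 zero = ·-zeroʳ 0
  o·x≡0⇒[q*o]·x≡0 {o} x o·x≡0 (suc q) = begin
    (o + q * o) · x        ≡⟨ ·-distribʳ-+ o (q * o) x ⟩
    o · x ⊕ (q * o) · x    ≡⟨ cong₂ _⊕_ o·x≡0 (o·x≡0⇒[q*o]·x≡0 x o·x≡0 q) ⟩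
    0ₙ ⊕ 0ₙ                ≡⟨ ⊕-identityʳ 0ₙ ⟩
    0ₙ                     ∎
    where open ≡-Reasoning

  order : ∀ (e : Fin n) → ∃[ o ] suc o · e ≡ 0ₙ × (∀ {t} → t < o → suc t · e ≢ 0ₙ)
  order e with minimal-witness (λ t → suc t · e ≡ 0ₙ) (λ t → suc t · e ≟ 0ₙ)
                 {w = pred n} (subst (λ m → m · e ≡ 0ₙ) (sym (suc-pred n)) (n·x≡0ₙ e))
  ... | o , o·e≡0 , _ , minimal = o , o·e≡0 , minimal

  ·-mod-order : ∀ {o} (e : Fin n) → suc o · e ≡ 0ₙ → ∀ i → i · e ≡ (i % suc o) · e
  ·-mod-order {o} e o·e≡0 i = begin
    i · e                                   ≡⟨ cong (_· e) (m≡m%n+[m/n]*n i (suc o)) ⟩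
    (i % suc o + i / suc o * suc o) · e     ≡⟨ ·-distribʳ-+ (i % suc o) _ e ⟩
    (i % suc o) · e ⊕ (i / suc o * suc o) · e ≡⟨ cong ((i % suc o) · e ⊕_) (o·x≡0⇒[q*o]·x≡0 e o·e≡0 (i / suc o)) ⟩
    (i % suc o) · e ⊕ 0ₙ                    ≡⟨ ⊕-identityʳ _ ⟩
    (i % suc o) · e                         ∎
    where open ≡-Reasoning

  AP-terms-differ : ∀ (g e : Fin n) {o} → (∀ {t} → t < o → suc t · e ≢ 0ₙ) →
    ∀ {i j} → j < suc o → i < j → g ⊕ i · e ≢ g ⊕ j · e
  AP-terms-differ g e minimal {i} j<o i<j eq with m≤n⇒∃[o]m+o≡n i<j
  ... | t , refl = minimal (<-≤-trans (s≤s (m≤n+m t i)) (s≤s⁻¹ j<o)) (∙-cancelˡ (i · e) _ _ (begin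
    i · e ⊕ suc t · e   ≡⟨ ·-distribʳ-+ i (suc t) e ⟨
    (i + suc t) · e     ≡⟨ cong (_· e) (+-suc i t) ⟩
    suc (i + t) · e     ≡⟨ ∙-cancelˡ g _ _ eq ⟨
    i · e               ≡⟨ ⊕-identityʳ (i · e) ⟨
    i · e ⊕ 0ₙ          ∎))
    where open ≡-Reasoning

  AP-terms-injective : ∀ (g e : Fin n) {o} → (∀ {t} → t < o → suc t · e ≢ 0ₙ) →
    ∀ {i j} → i < suc o → j < suc o → g ⊕ i · e ≡ g ⊕ j · e → i ≡ j
  AP-terms-injective g e minimal {i} {j} i<o j<o eq with <-cmp i j
  ... | tri< i<j _ _ = contradiction eq (AP-terms-differ g e minimal j<o i<j)
  ... | tri≈ _ i≡j _ = i≡j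
  ... | tri> _ _ j<i = contradiction (sym eq) (AP-terms-differ g e minimal i<o j<i)

  1<∣AP∣⇒step≢0 : ∀ (g e : Fin n) N → 1 < ∣ AP g e N ∣ → e ≢ 0ₙ
  1<∣AP∣⇒step≢0 g e N 1<∣P∣ refl = <⇒≱ 1<∣P∣ (begin
    ∣ AP g 0ₙ N ∣  ≤⟨ p⊆q⇒∣p∣≤∣q∣ AP⊆⁅g⁆ ⟩
    ∣ ⁅ g ⁆ ∣      ≡⟨ ∣⁅x⁆∣≡1 g ⟩
    1              ∎)
    where
    open ≤-Reasoning
    AP⊆⁅g⁆ : AP g 0ₙ N ⊆ ⁅ g ⁆
    AP⊆⁅g⁆ z∈ with ∈-AP⁻ g 0ₙ N z∈
    ... | i , _ , refl rewrite ·-zeroʳ i | ⊕-identityʳ g = x∈⁅x⁆ g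

  record DistinctPrefix (g e : Fin n) (N : ℕ) : Set where
    field
      length   : ℕ
      2≤length : 2 ≤ length
      length≤N : length ≤ N
      distinct : ∀ {i j} → i < length → j < length → g ⊕ i · e ≡ g ⊕ j · e → i ≡ j
      covers   : ∀ {i} → i < N → ∃[ i′ ] i′ < length × g ⊕ i · e ≡ g ⊕ i′ · e

  distinctPrefix : ∀ (g e : Fin n) N → 2 ≤ N → 1 < ∣ AP g e N ∣ → DistinctPrefix g e N
  distinctPrefix g e N 2≤N 1<∣P∣ with order e
  ... | o , o·e≡0 , minimal with N ≤? suc o
  ...   | yes N≤o = record
    { length = N ; 2≤length = 2≤N ; length≤N = ≤-refl
    ; distinct = λ i<N j<N → AP-terms-injective g e minimal (<-≤-trans i<N N≤o) (<-≤-trans j<N N≤o)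
    ; covers = λ {i} i<N → i , i<N , refl }
  ...   | no N≰o = record
    { length = suc o ; 2≤length = 2≤order o o·e≡0 ; length≤N = <⇒≤ (≰⇒> N≰o)
    ; distinct = AP-terms-injective g e minimal
    ; covers = λ {i} _ → i % suc o , m%n<n i (suc o) , cong (g ⊕_) (·-mod-order e o·e≡0 i) }
    where
    2≤order : ∀ o → suc o · e ≡ 0ₙ → 2 ≤ suc o
    2≤order zero 1·e≡0 = contradiction (trans (sym (·-identityˡ e)) 1·e≡0) (1<∣AP∣⇒step≢0 g e N 1<∣P∣)
    2≤order (suc o) _ = s≤s (s≤s z≤n)

module SubgroupOfℤₙ {n : ℕ} {{_ : NonZero n}} {L : Subset n} (L-subgroup : IsSubgroup L) where
  private
    ⊕-closed : ∀ x y → x ∈ L → y ∈ L → x ⊕ y ∈ L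
    ⊕-closed = proj₁ (proj₂ L-subgroup)

    ⊖-closed : ∀ x → x ∈ L → ⊖ x ∈ L
    ⊖-closed = proj₂ (proj₂ L-subgroup)

  [q*d]∈L : ∀ {d} → [ d ] ∈ L → ∀ q → [ q * d ] ∈ L
  [q*d]∈L [d]∈L zero = proj₁ L-subgroup
  [q*d]∈L {d} [d]∈L (suc q) = subst (_∈ L) ([]-+-homo d (q * d)) (⊕-closed _ _ [d]∈L ([q*d]∈L [d]∈L q))

  ∣⇒∈ : ∀ {d} → [ d ] ∈ L → ∀ x → d ∣ toℕ x → x ∈ L
  ∣⇒∈ [d]∈L x (divides q eq) = subst (_∈ L) (trans (cong [_] (sym eq)) ([]-toℕ x)) ([q*d]∈L [d]∈L q)

  ∈⇒∣ : ∀ {d-1} → [ suc d-1 ] ∈ L → (∀ {j} → j < d-1 → [ suc j ] ∉ L) → ∀ x → x ∈ L → suc d-1 ∣ toℕ x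
  ∈⇒∣ {d-1} [d]∈L minimal x x∈L = m%n≡0⇒n∣m (toℕ x) d remainder≡0
    where
    d = suc d-1
    q = toℕ x / d
    remainder≡0 : toℕ x % d ≡ 0
    remainder≡0 with toℕ x % d in r≡
    ... | zero = refl
    ... | suc r = contradiction [1+r]∈L (minimal (s≤s⁻¹ (subst (_< d) r≡ (m%n<n (toℕ x) d))))
      where
      [1+r]⊕[qd]≡x : [ suc r ] ⊕ [ q * d ] ≡ x
      [1+r]⊕[qd]≡x = begin
        [ suc r ] ⊕ [ q * d ]     ≡⟨ []-+-homo (suc r) (q * d) ⟩
        [ suc r + q * d ]         ≡⟨ cong (λ u → [ u + q * d ]) r≡ ⟨
        [ toℕ x % d + q * d ]     ≡⟨ cong [_] (m≡m%n+[m/n]*n (toℕ x) d) ⟨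
        [ toℕ x ]                 ≡⟨ []-toℕ x ⟩
        x                         ∎
        where open ≡-Reasoning
      [1+r]∈L : [ suc r ] ∈ L
      [1+r]∈L = subst (_∈ L) (sym (x≈z//y _ _ _ [1+r]⊕[qd]≡x)) (⊕-closed _ _ x∈L (⊖-closed _ ([q*d]∈L [d]∈L q)))

  [d]∈L⇒d∣n : ∀ {d} {{_ : NonZero d}} → [ d ] ∈ L → d < n → (∀ x → x ∈ L → d ∣ toℕ x) → d ∣ n
  [d]∈L⇒d∣n {d} [d]∈L d<n ∈⇒∣ =
    subst (d ∣_) (m∸n+n≡m (<⇒≤ d<n))
      (∣m∣n⇒∣m+n (subst (d ∣_) toℕ-⊖[d] (∈⇒∣ _ (⊖-closed _ [d]∈L))) ∣-refl)
    where
    toℕ-⊖[d] : toℕ (⊖ [ d ]) ≡ n ∸ d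
    toℕ-⊖[d] = begin
      toℕ [ n ∸ toℕ [ d ] ]   ≡⟨ toℕ-[] (n ∸ toℕ [ d ]) ⟩
      (n ∸ toℕ [ d ]) % n     ≡⟨ cong (λ u → (n ∸ u) % n) (trans (toℕ-[] d) (m<n⇒m%n≡m d<n)) ⟩
      (n ∸ d) % n             ≡⟨ m<n⇒m%n≡m (∸-monoʳ-< (>-nonZero⁻¹ d) (<⇒≤ d<n)) ⟩
      n ∸ d                   ∎
      where open ≡-Reasoning

  nonzero⇒multiples : Nonzero L → ∃[ d-1 ] suc d-1 < n × suc d-1 ∣ n × (∀ x → x ∈ L ⇔ suc d-1 ∣ toℕ x)
  nonzero⇒multiples (x₀ , x₀∈L , x₀≢0) with toℕ x₀ in x₀≡
  ... | zero = contradiction (trans (sym ([]-toℕ x₀)) (cong [_] x₀≡)) x₀≢0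
  ... | suc j with minimal-witness (λ j → [ suc j ] ∈ L) (λ j → [ suc j ] ∈? L)
                     (subst (_∈ L) (trans (sym ([]-toℕ x₀)) (cong [_] x₀≡)) x₀∈L)
  ...   | d-1 , [d]∈L , d-1≤j , minimal =
    d-1 , d<n , [d]∈L⇒d∣n [d]∈L d<n ∈L⇒∣ , λ x → mk⇔ (∈L⇒∣ x) (∣⇒∈ [d]∈L x)
    where
    d<n : suc d-1 < n
    d<n = ≤-<-trans (s≤s d-1≤j) (subst (_< n) x₀≡ (toℕ<n x₀))
    ∈L⇒∣ : ∀ x → x ∈ L → suc d-1 ∣ toℕ x
    ∈L⇒∣ = ∈⇒∣ [d]∈L minimal

module Reduction {n d : ℕ} {{_ : NonZero n}} {{_ : NonZero d}} (d∣n : d ∣ n) where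

  φ : Fin n → Fin d
  φ x = [ toℕ x ]

  ι : Fin d → Fin n
  ι y = [ toℕ y ]

  φ-[] : ∀ a → φ ([_] {n} a) ≡ [ a ]
  φ-[] a = %≡⇒[]≡ (trans (cong (_% d) (toℕ-[] a)) (m∣n⇒o%n%m≡o%m d n a d∣n))

  φ∘ι : ∀ y → φ (ι y) ≡ y
  φ∘ι y = trans (φ-[] (toℕ y)) ([]-toℕ y)

  φ-⊕ : ∀ x y → φ (x ⊕ y) ≡ φ x ⊕ φ y
  φ-⊕ x y = trans (φ-[] (toℕ x + toℕ y)) (sym ([]-+-homo (toℕ x) (toℕ y)))

  φ-⊖ : ∀ x → φ (⊖ x) ≡ ⊖ φ x
  φ-⊖ x = inverseʳ-unique (φ x) (φ (⊖ x)) (begin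
    φ x ⊕ φ (⊖ x)   ≡⟨ φ-⊕ x (⊖ x) ⟨
    φ (x ⊕ ⊖ x)     ≡⟨ cong φ (⊕-inverseʳ x) ⟩
    φ 0ₙ            ≡⟨ φ-[] 0 ⟩
    0ₙ              ∎)
    where open ≡-Reasoning

  φ-⊝ : ∀ x y → φ (x ⊝ y) ≡ φ x ⊝ φ y
  φ-⊝ x y = trans (φ-⊕ x (⊖ y)) (cong (φ x ⊕_) (φ-⊖ y))

  φ-· : ∀ i x → φ (i · x) ≡ i · φ x
  φ-· i x = trans (φ-[] (i * toℕ x)) (sym (·-[] i (toℕ x)))

  φ≡0⇔∣ : ∀ x → φ x ≡ 0ₙ ⇔ d ∣ toℕ x
  φ≡0⇔∣ x = mk⇔
    (λ φx≡0 → m%n≡0⇒n∣m (toℕ x) d (trans (sym (toℕ-[] (toℕ x))) (trans (cong toℕ φx≡0) toℕ-0ₙ)))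
    (λ d∣x → toℕ-injective (trans (toℕ-[] (toℕ x)) (trans (n∣m⇒m%n≡0 (toℕ x) d d∣x) (sym toℕ-0ₙ))))
    where
    toℕ-0ₙ : toℕ (0ₙ {d}) ≡ 0
    toℕ-0ₙ = trans (toℕ-[] 0) (m<n⇒m%n≡m (>-nonZero⁻¹ d))

  preimage : Subset d → Subset n
  preimage T = tabulate (lookup T ∘ φ)

  ∈-preimage⁻ : ∀ T {x} → x ∈ preimage T → φ x ∈ T
  ∈-preimage⁻ T {x} x∈ = lookup⇒[]= (φ x) T (∈-tabulate⁻ (lookup T ∘ φ) x∈)

  ∈-preimage⁺ : ∀ T {x} → φ x ∈ T → x ∈ preimage T
  ∈-preimage⁺ T φx∈ = ∈-tabulate⁺ (lookup T ∘ φ) ([]=⇒lookup φx∈)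

  ∣preimage∣ : ∀ T → ∣ preimage T ∣ ≡ n / d * ∣ T ∣
  ∣preimage∣ T = begin
    ∣ preimage T ∣               ≡⟨ ∣tabulate∣≡countBelow (lookup T ∘ φ) h (λ _ → refl) ⟩
    countBelow n h               ≡⟨ cong (λ m → countBelow m h) (m/n*n≡m d∣n) ⟨
    countBelow (n / d * d) h     ≡⟨ countBelow-periodic (n / d) d h periodic ⟩
    n / d * countBelow d h       ≡⟨ cong (n / d *_) ∣T∣≡countBelow ⟨
    n / d * ∣ tabulate (lookup T) ∣ ≡⟨ cong (λ p → n / d * ∣ p ∣) (tabulate∘lookup T) ⟩
    n / d * ∣ T ∣                ∎
    where
    open ≡-Reasoning
    h : ℕ → Bool
    h i = lookup T ([_] {d} i)
    ∣T∣≡countBelow : ∣ tabulate (lookup T) ∣ ≡ countBelow d h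
    ∣T∣≡countBelow = ∣tabulate∣≡countBelow (lookup T) h (cong (lookup T) ∘ sym ∘ []-toℕ)
    periodic : ∀ i → h (d + i) ≡ h i
    periodic i = cong (lookup T) (%≡⇒[]≡ (trans (cong (_% d) (+-comm d i)) ([m+n]%n≡m%n i d)))

  image : Subset n → Subset d
  image A = tabulate λ y → anyFin λ x → lookup A x ∧ ⌊ φ x ≟ y ⌋

  ∈-image⁻ : ∀ A {y} → y ∈ image A → ∃[ x ] x ∈ A × φ x ≡ y
  ∈-image⁻ A {y} y∈ with anyFin-true⁻ _ (∈-tabulate⁻ (λ y → anyFin λ x → lookup A x ∧ ⌊ φ x ≟ y ⌋) y∈)
  ... | x , x∈∧eq with true-∧⁻ {lookup A x} x∈∧eq
  ...   | x∈ , eq = x , lookup⇒[]= x A x∈ , ⌊⌋-true⁻ (φ x ≟ y) eq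

  ∈-image⁺ : ∀ A {x} → x ∈ A → φ x ∈ image A
  ∈-image⁺ A {x} x∈ = ∈-tabulate⁺ (λ y → anyFin λ x → lookup A x ∧ ⌊ φ x ≟ y ⌋)
    (anyFin-true⁺ (λ x′ → lookup A x′ ∧ ⌊ φ x′ ≟ φ x ⌋)
      (true-∧⁺ ([]=⇒lookup x∈) (⌊⌋-true⁺ (φ x ≟ φ x) refl)))

  image-+ₛ : ∀ A B → image (A +ₛ B) ≡ image A +ₛ image B
  image-+ₛ A B = ⊆-antisym image⊆ ⊆image
    where
    image⊆ : image (A +ₛ B) ⊆ image A +ₛ image B
    image⊆ z∈ with ∈-image⁻ (A +ₛ B) z∈
    ... | s , s∈ , refl with ∈-+ₛ⁻ A B s∈
    ...   | x , y , x∈ , y∈ , refl = ∈-+ₛ⁺ _ _ (∈-image⁺ A x∈) (∈-image⁺ B y∈) (sym (φ-⊕ x y))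
    ⊆image : image A +ₛ image B ⊆ image (A +ₛ B)
    ⊆image z∈ with ∈-+ₛ⁻ (image A) (image B) z∈
    ... | u , v , u∈ , v∈ , refl with ∈-image⁻ A u∈ | ∈-image⁻ B v∈
    ...   | x , x∈ , refl | y , y∈ , refl =
      subst (_∈ image (A +ₛ B)) (φ-⊕ x y) (∈-image⁺ (A +ₛ B) (∈-+ₛ⁺ A B x∈ y∈ refl))

  preimage-isSubgroup : ∀ {H} → IsSubgroup H → IsSubgroup (preimage H)
  preimage-isSubgroup {H} (0∈H , ⊕-closed , ⊖-closed) =
      ∈-preimage⁺ H (subst (_∈ H) (sym (φ-[] 0)) 0∈H)
    , (λ x y x∈ y∈ → ∈-preimage⁺ H
        (subst (_∈ H) (sym (φ-⊕ x y)) (⊕-closed _ _ (∈-preimage⁻ H x∈) (∈-preimage⁻ H y∈))))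
    , (λ x x∈ → ∈-preimage⁺ H (subst (_∈ H) (sym (φ-⊖ x)) (⊖-closed _ (∈-preimage⁻ H x∈))))

  preimage-proper : ∀ {H} → Proper H → Proper (preimage H)
  preimage-proper {H} (y , y∉H) = ι y , λ ιy∈ → y∉H (subst (_∈ H) (φ∘ι y) (∈-preimage⁻ H ιy∈))

  SameCoset-preimage : ∀ H {x y} → SameCoset (preimage H) x y ⇔ SameCoset H (φ x) (φ y)
  SameCoset-preimage H {x} {y} = mk⇔
    (λ x-y∈ → subst (_∈ H) (φ-⊝ x y) (∈-preimage⁻ H x-y∈))
    (λ φx-φy∈ → ∈-preimage⁺ H (subst (_∈ H) (sym (φ-⊝ x y)) φx-φy∈))

  SameCoset-ι : ∀ H u x → SameCoset (preimage H) (ι u) x ⇔ SameCoset H u (φ x)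
  SameCoset-ι H u x = subst (λ v → SameCoset (preimage H) (ι u) x ⇔ SameCoset H v (φ x)) (φ∘ι u) (SameCoset-preimage H)

  φ-term : ∀ g e i → φ (g ⊕ i · e) ≡ φ g ⊕ i · φ e
  φ-term g e i = trans (φ-⊕ g (i · e)) (cong (φ g ⊕_) (φ-· i e))

  InProperCoset-image : ∀ A → InProperCoset (image A) → InProperCoset A
  InProperCoset-image A (H , H-subgroup , H-proper , g , covered) =
    preimage H , preimage-isSubgroup H-subgroup , preimage-proper H-proper , ι g ,
    λ a a∈ → Equivalence.from (SameCoset-preimage H)
      (subst (SameCoset H (φ a)) (sym (φ∘ι g)) (covered (φ a) (∈-image⁺ A a∈)))

  CosetsFormAP-preimage : ∀ H {a b c} → CosetsFormAP (preimage H) a b c → CosetsFormAP H (φ a) (φ b) (φ c)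
  CosetsFormAP-preimage H {a} {b} {c} (G , D , M , 2≤M , F) = φ G , φ D , M , 2≤M , λ u → to-AP u , from-AP u
    where
    lift : ∀ u x → SameCoset H u (φ x) → SameCoset (preimage H) (ι u) x
    lift u x = Equivalence.from (SameCoset-ι H u x)
    lower : ∀ u x → SameCoset (preimage H) (ι u) x → SameCoset H u (φ x)
    lower u x = Equivalence.to (SameCoset-ι H u x)
    to-AP : ∀ u → SameCoset H u (φ a) ⊎ SameCoset H u (φ b) ⊎ SameCoset H u (φ c) →
            ∃[ i ] i < M × SameCoset H u (φ G ⊕ i · φ D)
    to-AP u in-abc with proj₁ (F (ι u)) (Sum.map (lift u a) (Sum.map (lift u b) (lift u c)) in-abc)
    ... | i , i<M , s = i , i<M , subst (SameCoset H u) (φ-term G D i) (lower u _ s)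
    from-AP : ∀ u → ∃[ i ] i < M × SameCoset H u (φ G ⊕ i · φ D) →
              SameCoset H u (φ a) ⊎ SameCoset H u (φ b) ⊎ SameCoset H u (φ c)
    from-AP u (i , i<M , s) = Sum.map (lower u a) (Sum.map (lower u b) (lower u c))
      (proj₂ (F (ι u)) (i , i<M , lift u _ (subst (SameCoset H u) (sym (φ-term G D i)) s)))

  image⊆⇒⊆preimage : ∀ A P H P′ → (∀ {p} → p ∈ P → ∃[ t ] t ∈ P′ × φ t ≡ p) →
    image A ⊆ P +ₛ H → A ⊆ P′ +ₛ preimage H
  image⊆⇒⊆preimage A P H P′ lifts image⊆ {x} x∈ with ∈-+ₛ⁻ P H (image⊆ (∈-image⁺ A x∈))
  ... | p , h , p∈ , h∈ , p⊕h≡φx with lifts p∈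
  ...   | t , t∈ , φt≡p =
    ∈-+ₛ⁺ P′ (preimage H) t∈ (∈-preimage⁺ H (subst (_∈ H) (sym φ[x⊝t]≡h) h∈)) (x⊕[y⊝x]≡y t x)
    where
    φ[x⊝t]≡h : φ (x ⊝ t) ≡ h
    φ[x⊝t]≡h = begin
      φ (x ⊝ t)       ≡⟨ φ-⊝ x t ⟩
      φ x ⊝ φ t       ≡⟨ cong₂ _⊝_ p⊕h≡φx (sym φt≡p) ⟨
      (p ⊕ h) ⊝ p     ≡⟨ xyx⁻¹≈y p h ⟩
      h               ∎
      where open ≡-Reasoning

  -- Lifting only a prefix with distinct terms keeps the lifted progression no larger than the original.
  module LiftedAP {g e : Fin d} {N : ℕ} (prefix : DistinctPrefix g e N) where
    open DistinctPrefix prefix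

    liftedAP : Subset n
    liftedAP = AP (ι g) (ι e) length

    φ-lifted-term : ∀ i → φ (ι g ⊕ i · ι e) ≡ g ⊕ i · e
    φ-lifted-term i = trans (φ-term (ι g) (ι e) i) (cong₂ (λ u v → u ⊕ i · v) (φ∘ι g) (φ∘ι e))

    AP-lifts : ∀ {p} → p ∈ AP g e N → ∃[ t ] t ∈ liftedAP × φ t ≡ p
    AP-lifts p∈ with ∈-AP⁻ g e N p∈
    ... | i , i<N , refl with covers i<N
    ...   | i′ , i′<length , same =
      ι g ⊕ i′ · ι e , ∈-AP⁺ (ι g) (ι e) length i′<length , trans (φ-lifted-term i′) (sym same)

    ∣liftedAP∣≤∣AP∣ : ∣ liftedAP ∣ ≤ ∣ AP g e N ∣
    ∣liftedAP∣≤∣AP∣ = injection⇒∣p∣≤∣q∣ liftedAP (AP g e N) φ into injective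
      where
      into : ∀ {t} → t ∈ liftedAP → φ t ∈ AP g e N
      into t∈ with ∈-AP⁻ (ι g) (ι e) length t∈
      ... | i , i<length , refl = subst (_∈ AP g e N) (sym (φ-lifted-term i)) (∈-AP⁺ g e N (<-≤-trans i<length length≤N))
      injective : ∀ {t u} → t ∈ liftedAP → u ∈ liftedAP → φ t ≡ φ u → t ≡ u
      injective t∈ u∈ φt≡φu with ∈-AP⁻ (ι g) (ι e) length t∈ | ∈-AP⁻ (ι g) (ι e) length u∈
      ... | i , i< , refl | j , j< , refl =
        cong (λ k → ι g ⊕ k · ι e) (distinct i< j< (trans (sym (φ-lifted-term i)) (trans φt≡φu (φ-lifted-term j))))

    1<∣liftedAP∣ : 1 < ∣ liftedAP ∣
    1<∣liftedAP∣ =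
      x∈p∧y∈p∧x≢y⇒1<∣p∣ (∈-AP⁺ (ι g) (ι e) length 0<length) (∈-AP⁺ (ι g) (ι e) length 2≤length) 0≢1
      where
      0<length : 0 < length
      0<length = <-≤-trans (s≤s z≤n) 2≤length
      0≢1 : ι g ⊕ 0 · ι e ≢ ι g ⊕ 1 · ι e
      0≢1 eq = contradiction (distinct 0<length 2≤length
        (trans (sym (φ-lifted-term 0)) (trans (cong φ eq) (φ-lifted-term 1)))) (λ ())

  module Kernel (L : Subset n) (L⇔ : ∀ x → x ∈ L ⇔ d ∣ toℕ x) where

    private
      ∈L⇒φ≡0 : ∀ {x} → x ∈ L → φ x ≡ 0ₙ
      ∈L⇒φ≡0 {x} = Equivalence.from (φ≡0⇔∣ x) ∘ Equivalence.to (L⇔ x)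

      φ≡0⇒∈L : ∀ {x} → φ x ≡ 0ₙ → x ∈ L
      φ≡0⇒∈L {x} = Equivalence.from (L⇔ x) ∘ Equivalence.to (φ≡0⇔∣ x)

    +ₛL≡preimage-image : ∀ S → S +ₛ L ≡ preimage (image S)
    +ₛL≡preimage-image S = ⊆-antisym ⊆preimage preimage⊆
      where
      ⊆preimage : S +ₛ L ⊆ preimage (image S)
      ⊆preimage z∈ with ∈-+ₛ⁻ S L z∈
      ... | s , l , s∈ , l∈ , refl = ∈-preimage⁺ (image S) (subst (_∈ image S) (sym φ[s⊕l]≡φs) (∈-image⁺ S s∈))
        where
        φ[s⊕l]≡φs : φ (s ⊕ l) ≡ φ s
        φ[s⊕l]≡φs = trans (φ-⊕ s l) (trans (cong (φ s ⊕_) (∈L⇒φ≡0 l∈)) (⊕-identityʳ (φ s)))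
      preimage⊆ : preimage (image S) ⊆ S +ₛ L
      preimage⊆ {z} z∈ with ∈-image⁻ S (∈-preimage⁻ (image S) z∈)
      ... | s , s∈ , φs≡φz = ∈-+ₛ⁺ S L s∈ (φ≡0⇒∈L φ[z⊝s]≡0) (x⊕[y⊝x]≡y s z)
        where
        φ[z⊝s]≡0 : φ (z ⊝ s) ≡ 0ₙ
        φ[z⊝s]≡0 = trans (φ-⊝ z s) (trans (cong (φ z ⊝_) φs≡φz) (⊕-inverseʳ (φ z)))

    ⊆+ₛL : ∀ S → S ⊆ S +ₛ L
    ⊆+ₛL S {x} x∈ = ∈-+ₛ⁺ S L x∈ (φ≡0⇒∈L (φ-[] 0)) (⊕-identityʳ x)

    ∣+ₛL∣ : ∀ S → ∣ S +ₛ L ∣ ≡ n / d * ∣ image S ∣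
    ∣+ₛL∣ S = trans (cong ∣_∣ (+ₛL≡preimage-image S)) (∣preimage∣ (image S))

module Descent {n d : ℕ} {{_ : NonZero n}} {{_ : NonZero d}} (d∣n : d ∣ n)
  (L : Subset n) (L⇔ : ∀ x → x ∈ L ⇔ d ∣ toℕ x) (A : Subset n)
  (excess : ∣ (A +ₛ A) +ₛ L ∣ + ∣ A ∣ ≤ ∣ A +ₛ L ∣ + ∣ A +ₛ A ∣) where

  open Reduction d∣n
  open Kernel L L⇔

  k : ℕ
  k = n / d

  B : Subset d
  B = image A

  ∣2A+L∣ : ∣ (A +ₛ A) +ₛ L ∣ ≡ k * ∣ B +ₛ B ∣
  ∣2A+L∣ = trans (∣+ₛL∣ (A +ₛ A)) (cong (λ p → k * ∣ p ∣) (image-+ₛ A A))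

  image-excess : k * ∣ B +ₛ B ∣ + ∣ A ∣ ≤ k * ∣ B ∣ + ∣ A +ₛ A ∣
  image-excess = subst₂ (λ u v → u + ∣ A ∣ ≤ v + ∣ A +ₛ A ∣) ∣2A+L∣ (∣+ₛL∣ A) excess

  ∣A∣≤k∣B∣ : ∣ A ∣ ≤ k * ∣ B ∣
  ∣A∣≤k∣B∣ = subst (∣ A ∣ ≤_) (∣+ₛL∣ A) (p⊆q⇒∣p∣≤∣q∣ (⊆+ₛL A))

  image-small-doubling : 4 * ∣ A +ₛ A ∣ < 9 * ∣ A ∣ → 4 * ∣ B +ₛ B ∣ < 9 * ∣ B ∣
  image-small-doubling =
    small-doubling-transfer k (∣ B ∣) (∣ B +ₛ B ∣) (∣ A ∣) (∣ A +ₛ A ∣) image-excess ∣A∣≤k∣B∣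

  image-excess-transfer : ∀ {R x} → R ≤ k * x → x + ∣ B ∣ ≤ ∣ B +ₛ B ∣ → R + ∣ A ∣ ≤ ∣ A +ₛ A ∣
  image-excess-transfer R≤kx x+b≤b₂ =
    excess-transfer k (∣ B ∣) (∣ B +ₛ B ∣) (∣ A ∣) (∣ A +ₛ A ∣) R≤kx x+b≤b₂ image-excess

  ∣2B∣<d : (A +ₛ A) +ₛ L ≢ ⊤ → ∣ B +ₛ B ∣ < d
  ∣2B∣<d 2A+L≢⊤ = ≰⇒> λ d≤∣2B∣ → 2A+L≢⊤ (∣p∣≡n⇒p≡⊤ (begin
    ∣ (A +ₛ A) +ₛ L ∣   ≡⟨ ∣2A+L∣ ⟩
    k * ∣ B +ₛ B ∣      ≡⟨ cong (k *_) (≤-antisym (∣p∣≤n (B +ₛ B)) d≤∣2B∣) ⟩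
    k * d               ≡⟨ m/n*n≡m d∣n ⟩
    n                   ∎))
    where open ≡-Reasoning

  -- Stated for a variable c: with the literal 24000 the unifier would unfold 24000 * _ term by term.
  image-scaled-excess : ∀ c → d + c * ∣ B ∣ ≤ c * ∣ B +ₛ B ∣ → n + c * ∣ A ∣ ≤ c * ∣ A +ₛ A ∣
  image-scaled-excess c condI = excess-transfer k (c * ∣ B ∣) (c * ∣ B +ₛ B ∣) (c * ∣ A ∣) (c * ∣ A +ₛ A ∣)
    (≤-reflexive (sym (m/n*n≡m d∣n))) condI
    (excess-scale c k (∣ B ∣) (∣ B +ₛ B ∣) (∣ A ∣) (∣ A +ₛ A ∣) image-excess)

  CondI-image : CondI d B → CondI n A
  CondI-image = image-scaled-excess 24000

  CondII-image : CondII d B → CondII n A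
  CondII-image (H , H-subgroup , H-proper , g , e , N , 2≤N , 1<∣P∣ , B⊆P+H , condII) =
    preimage H , preimage-isSubgroup H-subgroup , preimage-proper H-proper , ι g , ι e , length , 2≤length ,
    1<∣liftedAP∣ , image⊆⇒⊆preimage A (AP g e N) H liftedAP AP-lifts B⊆P+H ,
    image-excess-transfer lifted≤k*original condII
    where
    prefix = distinctPrefix g e N 2≤N 1<∣P∣
    open DistinctPrefix prefix
    open LiftedAP prefix
    lifted≤k*original : (∣ liftedAP ∣ ∸ 1) * ∣ preimage H ∣ ≤ k * ((∣ AP g e N ∣ ∸ 1) * ∣ H ∣)
    lifted≤k*original = begin
      (∣ liftedAP ∣ ∸ 1) * ∣ preimage H ∣   ≡⟨ cong ((∣ liftedAP ∣ ∸ 1) *_) (∣preimage∣ H) ⟩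
      (∣ liftedAP ∣ ∸ 1) * (k * ∣ H ∣)      ≤⟨ *-monoˡ-≤ (k * ∣ H ∣) (∸-monoˡ-≤ 1 ∣liftedAP∣≤∣AP∣) ⟩
      (∣ AP g e N ∣ ∸ 1) * (k * ∣ H ∣)      ≡⟨ swap (∣ AP g e N ∣ ∸ 1) k ∣ H ∣ ⟩
      k * ((∣ AP g e N ∣ ∸ 1) * ∣ H ∣)      ∎
      where
      open ≤-Reasoning
      swap : ∀ x k h → x * (k * h) ≡ k * (x * h)
      swap = solve-∀

  CondIII-image : CondIII d B → CondIII n A
  CondIII-image (H , H-subgroup , H-proper , a , b , c , a∈ , b∈ , c∈ , a≁b , a≁c , b≁c , covered , ¬AP , condIII)
    with ∈-image⁻ A a∈ | ∈-image⁻ A b∈ | ∈-image⁻ A c∈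
  ... | a′ , a′∈ , refl | b′ , b′∈ , refl | c′ , c′∈ , refl =
    preimage H , preimage-isSubgroup H-subgroup , preimage-proper H-proper , a′ , b′ , c′ , a′∈ , b′∈ , c′∈ ,
    a≁b ∘ lower , a≁c ∘ lower , b≁c ∘ lower ,
    (λ x x∈ → Sum.map lift (Sum.map lift lift) (covered (φ x) (∈-image⁺ A x∈))) ,
    ¬AP ∘ CosetsFormAP-preimage H ,
    image-excess-transfer (≤-reflexive 3∣preimage∣≡k*3∣H∣) condIII
    where
    lower : ∀ {x y} → SameCoset (preimage H) x y → SameCoset H (φ x) (φ y)
    lower = Equivalence.to (SameCoset-preimage H)
    lift : ∀ {x y} → SameCoset H (φ x) (φ y) → SameCoset (preimage H) x y
    lift = Equivalence.from (SameCoset-preimage H)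
    3∣preimage∣≡k*3∣H∣ : 3 * ∣ preimage H ∣ ≡ k * (3 * ∣ H ∣)
    3∣preimage∣≡k*3∣H∣ = trans (cong (3 *_) (∣preimage∣ H)) (swap k ∣ H ∣)
      where
      swap : ∀ k h → 3 * (k * h) ≡ k * (3 * h)
      swap = solve-∀

  image-counterexample : Counterexample n A → (A +ₛ A) +ₛ L ≢ ⊤ → Counterexample d B
  image-counterexample (¬coset , small , _ , ¬I , ¬II , ¬III) 2A+L≢⊤ =
    ¬coset ∘ InProperCoset-image A , image-small-doubling small , ∣2B∣<d 2A+L≢⊤ ,
    ¬I ∘ CondI-image , ¬II ∘ CondII-image , ¬III ∘ CondIII-image

lemma11 : (n : ℕ) {{_ : NonZero n}} →
    ((m : ℕ) {{_ : NonZero m}} → m < n → (B : Subset m) → ¬ Counterexample m B) →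
    (A : Subset n) → Counterexample n A →
    (L : Subset n) → IsSubgroup L → Nonzero L → (A +ₛ A) +ₛ L ≢ ⊤ →
    ∣ A +ₛ L ∣ + ∣ A +ₛ A ∣ < ∣ (A +ₛ A) +ₛ L ∣ + ∣ A ∣
lemma11 n {{n≢0}} minimal A counterexample L L-subgroup L-nonzero 2A+L≢⊤ =
  ≰⇒> (no-excess (SubgroupOfℤₙ.nonzero⇒multiples L-subgroup L-nonzero))
  where
  no-excess : ∃[ d-1 ] suc d-1 < n × suc d-1 ∣ n × (∀ x → x ∈ L ⇔ suc d-1 ∣ toℕ x) →
              ∣ (A +ₛ A) +ₛ L ∣ + ∣ A ∣ ≰ ∣ A +ₛ L ∣ + ∣ A +ₛ A ∣
  -- The explicit instance stops Agda from unfolding Counterexample while the instance is unresolved.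
  no-excess (d-1 , d<n , d∣n , L⇔) excess =
    minimal (suc d-1) d<n _ (Descent.image-counterexample {{n≢0}} d∣n L L⇔ A excess counterexample 2A+L≢⊤)
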